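{- Let $A$, $Q$ and $H\subseteq A^Q$ be non-empty finite sets, and let $\mathcal{F}$ be a clone with carrier $A$ satisfying $\Delta^{2}$. Then $H\in\mathrm{Inv}_Q\, \mathcal{F}$ if and only if both of the following hold: (1) $H|_{P}\in \mathrm{Inv}_P\, \mathcal{F}$ for all $P\in [Q]^1\cup \{\,Q^{[B]}_H\colon B\in [A]^2\,\}$; (2) $H$ is decomposable over $[Q]^1\cup [Q]^{2,id}_{H}\cup \{\,Q^{[B]}_H\colon B\in [A]^2\,\}$.
   Context: $\mathcal{O}(A)=\bigcup_{n<\omega}A^{A^n}$; elements of $A^n$ are sequences $\mathbf{a}=a_0\ldots a_{n-1}$, $\mathrm{ran}\,\mathbf{a}$ is the set of their entries, $A^2_2=\{\mathbf{a}\in A^2\colon|\mathrm{ran}\,\mathbf{a}|=2\}$; $\mathcal{F}_{[n]}$ is the set of $n$-ary functions of $\mathcal{F}$. A clone on $A$ is a subset of $\mathcal{O}(A)$ containing all projections and closed under composition. For $n$-ary $g$ and $h_0,\ldots,h_{n-1}\in A^Q$, $g(h_0,\ldots,h_{n-1})(q)=g(h_0(q)\ldots h_{n-1}(q))$; $g$ preserves $H\subseteq A^Q$ if $g(h_0,\ldots,h_{n-1})\in H$ for all $h_i\in H$; $\mathrm{Inv}_Q\,\mathcal{F}$ is the set of all $H\subseteq A^Q$ preserved by every $g\in\mathcal{F}$. For functions: $h|_P=h\cap(P\times A)$, $h|^P=\{g\in A^{P\cup\mathrm{dom}\,h}\colon g|_{\mathrm{dom}\,h}=h\}$, $H|_P=\{h|_P\colon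 h\in H\}$, $H|^P=\bigcup_{h\in H}h|^P$. For $\mathscr R\subseteq\mathscr P(Q)$, $H$ is decomposable over $\mathscr R$ if $H=\bigcap_{R\in\mathscr R}(H|_R)|^Q$. Let $H(q)=\{h(q)\colon h\in H\}$, $[X]^k$ the set of $k$-element subsets of $X$, $[Q]^{2,id}_H$ the set of $\{p,q\}\in[Q]^2$ with $h(p)=h(q)$ for all $h\in H$, and, for $B\subseteq A$, $Q^{[B]}_H=\{q\in Q\colon H(q)\subseteq B\}$. The clone $\mathcal{F}$ satisfies $\Delta^2$ if for all $\mathbf{a},\mathbf{b}\in A^2_2$ with $\mathrm{ran}\,\mathbf{a}\neq\mathrm{ran}\,\mathbf{b}$ and all $a\in\mathrm{ran}\,\mathbf{a}$, $b\in\mathrm{ran}\,\mathbf{b}$ there is $w\in\mathcal{F}_{[2]}$ with $w(\mathbf{a})=a$, $w(\mathbf{b})=b$ and $w(xx)=x$ for all $x\in A$. -}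

module Defs where

open import Data.Nat using (ℕ; suc)
open import Data.Fin using (Fin)
open import Data.Vec using (Vec; lookup; tabulate)
open import Data.List using (List)
open import Data.List.Membership.Propositional using (_∈_)
open import Data.Product using (Σ; ∃; _×_; _,_; proj₁)
open import Data.Sum using (_⊎_)
open import Relation.Binary.PropositionalEquality using (_≡_; _≢_)
open import Relation.Nullary using (¬_)
open import Level using (suc; zero)

Op : Set → ℕ → Set
Op A k = Vec A k → A

OpSet : Set → Set₁
OpSet A = ∀ {k} → Op A k → Set

record IsClone {A : Set} (F : OpSet A) : Set where
  field
    extensional : ∀ {k} (f g : Op A k) → (∀ xs → f xs ≡ g xs) → F f → F g
    projections : ∀ k (i : Fin k) → F (λ (xs : Vec A k) → lookup xs i)
    composition : ∀ {k l} (f : Op A k) (gs : Fin k → Op A l) →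
                  F f → (∀ i → F (gs i)) →
                  F (λ xs → f (tabulate (λ i → gs i xs)))

apply : ∀ {A D : Set} {k} → Op A k → (Fin k → D → A) → D → A
apply g hs d = g (tabulate (λ i → hs i d))

Preserves : ∀ {A D : Set} {k} → Op A k → ((D → A) → Set) → Set
Preserves {k = k} g K = ∀ hs → (∀ (i : Fin k) → K (hs i)) → K (apply g hs)

Inv : ∀ {A D : Set} → OpSet A → ((D → A) → Set) → Set
Inv F K = ∀ {k} (g : Op _ k) → F g → Preserves g K

SameRan : ∀ {A : Set} → A → A → A → A → Set
SameRan x0 x1 y0 y1 =
  ∀ x → ((x ≡ x0 ⊎ x ≡ x1) → (x ≡ y0 ⊎ x ≡ y1)) × ((x ≡ y0 ⊎ x ≡ y1) → (x ≡ x0 ⊎ x ≡ x1))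

Δ² : ∀ {A : Set} → OpSet A → Set
Δ² {A} F =
  ∀ (a0 a1 b0 b1 : A) → a0 ≢ a1 → b0 ≢ b1 → ¬ SameRan a0 a1 b0 b1 →
  ∀ (a b : A) → (a ≡ a0 ⊎ a ≡ a1) → (b ≡ b0 ⊎ b ≡ b1) →
  Σ (Op A 2) λ w → F w × w (a0 ∷ a1 ∷ []) ≡ a × w (b0 ∷ b1 ∷ []) ≡ b
                       × (∀ x → w (x ∷ x ∷ []) ≡ x)
  where open Data.Vec using (_∷_; [])

module _ {A : Set} {m : ℕ} (H : List (Vec A m)) where

  -- H viewed as a subset of A^Q (Q = Fin m)
  ⟦_⟧ : (Fin m → A) → Set
  ⟦_⟧ f = ∃ λ h → h ∈ H × (∀ q → lookup h q ≡ f q)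

  -- H|_P ⊆ A^P, where A^P = functions on Σ Q P
  Restr : (P : Fin m → Set) → (Σ (Fin m) P → A) → Set
  Restr P f = ∃ λ h → h ∈ H × (∀ (x : Σ (Fin m) P) → lookup h (proj₁ x) ≡ f x)

  InExt : (P : Fin m → Set) → (Fin m → A) → Set
  InExt P f = ∃ λ h → h ∈ H × (∀ q → P q → lookup h q ≡ f q)

  Decomposable : {I : Set} → (I → Fin m → Set) → Set
  Decomposable R = ∀ (f : Fin m → A) → (⟦_⟧ f → (∀ i → InExt (R i) f)) × ((∀ i → InExt (R i) f) → ⟦_⟧ f)

  QB : A → A → Fin m → Set
  QB a b q = ∀ h → h ∈ H → (lookup h q ≡ a ⊎ lookup h q ≡ b)

  Single : Fin m → Fin m → Set
  Single q = λ x → x ≡ q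

  IdPairIdx : Set
  IdPairIdx = Σ (Fin m) λ p → Σ (Fin m) λ q → p ≢ q × (∀ h → h ∈ H → lookup h p ≡ lookup h q)

  IdPair : IdPairIdx → Fin m → Set
  IdPair (p , q , _) = λ x → x ≡ p ⊎ x ≡ q

  TwoIdx : Set
  TwoIdx = Σ A λ a → Σ A λ b → a ≢ b

  QBfam : TwoIdx → Fin m → Set
  QBfam (a , b , _) = QB a b

  Family : Fin m ⊎ IdPairIdx ⊎ TwoIdx → Fin m → Set
  Family (Data.Sum.inj₁ q) = Single q
  Family (Data.Sum.inj₂ (Data.Sum.inj₁ i)) = IdPair i
  Family (Data.Sum.inj₂ (Data.Sum.inj₂ j)) = QBfam j

module Submission where

-- Only the decomposability of an invariant H needs work.  Call g : Q → A
-- "locally consistent on S ⊆ Q" if it agrees with members of H on every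
-- singleton, every identity pair and every Q^{[B]}_H inside S.  We show by
-- well-founded induction on |S| that every such g agrees on S with a member
-- of H.  The induction hypothesis provides, for each t ∈ S, a "near solution"
-- in H agreeing with g on S ∖ {t}.  Since solvability is decidable we argue
-- by contradiction.  The single tool is the binary operation w ∈ F given by
-- Δ²: it merges two members of H, prescribing values at two coordinates and
-- keeping every coordinate where they agree.  Merging near solutions shows
-- that any two of them must "conflict" (their wrong values form the same
-- two-element set); tracking these conflicts, after overwriting g at points
-- that lie in no Q^{[B]}_H, yields the contradiction.

open import Defs
open import Data.Nat using (ℕ; suc; _<_)
open import Data.Nat.Induction using (<-wellFounded)
open import Data.Fin using (Fin; _≟_)
import Data.Fin as Fin
open import Data.Vec using (Vec; lookup; []; _∷_)
open import Data.Vec.Properties using (tabulate-cong)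
open import Data.Vec.Functional using (updateAt)
open import Data.Vec.Functional.Properties using (updateAt-updates; updateAt-minimal)
open import Data.List using (List; []; _∷_; length; filter; allFin)
open import Data.List.Properties using (filter-notAll)
open import Data.List.Membership.Propositional using (_∈_; find; lose)
open import Data.List.Membership.Propositional.Properties using (∈-filter⁺; ∈-filter⁻; ∈-allFin)
open import Data.List.Relation.Unary.Any using (Any; here; any?)
open import Data.List.Relation.Unary.All as All using (All; all?)
open import Data.List.Relation.Unary.All.Properties using (¬All⇒Any¬)
open import Data.Product using (Σ; ∃; _×_; _,_; proj₁; proj₂)
open import Data.Sum using (_⊎_; inj₁; inj₂; [_,_]′)
import Data.Sum as Sum
open import Data.Empty using (⊥; ⊥-elim)
open import Function using (_∘_; _on_; const; case_of_)
open import Induction.WellFounded using (Acc; acc)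
import Relation.Binary.Construct.On as On
open import Relation.Binary.PropositionalEquality
  using (_≡_; _≢_; refl; sym; trans; cong; subst; ≢-sym)
open import Relation.Nullary using (¬_; Dec; yes; no)
open import Relation.Nullary.Decidable using (map′; _⊎-dec_; _×-dec_; ¬?; decidable-stable)
open import Relation.Unary using (Decidable)
open import Relation.Binary.Definitions using (DecidableEquality)

module _ {X : Set} {P : X → Set} (P? : Decidable P) where

  all∈? : ∀ xs → Dec (∀ x → x ∈ xs → P x)
  all∈? xs = map′ (λ a x x∈ → All.lookup a x∈) (λ f → All.tabulate (λ {x} x∈ → f x x∈)) (all? P? xs)

  counterexample : ∀ xs → ¬ (∀ x → x ∈ xs → P x) → ∃ λ x → x ∈ xs × ¬ P x
  counterexample xs ¬all = find (¬All⇒Any¬ P? xs (λ a → ¬all (λ x x∈ → All.lookup a x∈)))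

nonempty : ∀ {X : Set} {xs : List X} → ¬ (xs ≡ []) → ∃ λ x → x ∈ xs
nonempty {xs = []} xs≢[] = ⊥-elim (xs≢[] refl)
nonempty {xs = x ∷ _} _ = x , here refl

module _ {A : Set} where

  InPair : A → A → A → Set
  InPair v a b = v ≡ a ⊎ v ≡ b

  SamePair : A → A → A → A → Set
  SamePair a₀ a₁ b₀ b₁ = (a₀ ≡ b₀ × a₁ ≡ b₁) ⊎ (a₀ ≡ b₁ × a₁ ≡ b₀)

  samePair-fst : ∀ {a₀ a₁ b₀ b₁} → SamePair a₀ a₁ b₀ b₁ → InPair a₀ b₀ b₁
  samePair-fst (inj₁ (e , _)) = inj₁ e
  samePair-fst (inj₂ (e , _)) = inj₂ e

  samePair-snd : ∀ {a₀ a₁ b₀ b₁} → SamePair a₀ a₁ b₀ b₁ → InPair a₁ b₀ b₁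
  samePair-snd (inj₁ (_ , e)) = inj₂ e
  samePair-snd (inj₂ (_ , e)) = inj₁ e

  samePair-other : ∀ {a₀ a₁ b₀ b₁} → SamePair a₀ a₁ b₀ b₁ → a₀ ≡ b₀ → b₀ ≢ b₁ → a₁ ≡ b₁
  samePair-other (inj₁ (_ , a₁≡b₁)) _ _ = a₁≡b₁
  samePair-other (inj₂ (a₀≡b₁ , _)) a₀≡b₀ b₀≢b₁ = ⊥-elim (b₀≢b₁ (trans (sym a₀≡b₀) a₀≡b₁))

  outside-samePair : ∀ {z a₀ a₁ b₀ b₁} → SamePair a₀ a₁ b₀ b₁ → ¬ InPair z a₀ a₁ → ¬ InPair z b₀ b₁
  outside-samePair (inj₁ (refl , refl)) z∉ = z∉
  outside-samePair (inj₂ (refl , refl)) z∉ = z∉ ∘ Sum.swap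

  outside⇒≢ : ∀ {z v a b} → ¬ InPair z a b → InPair v a b → z ≢ v
  outside⇒≢ z∉ v∈ refl = z∉ v∈

  pigeonhole : ∀ {x y w a b} → InPair x a b → InPair y a b → InPair w a b →
               x ≢ y → x ≢ w → y ≢ w → ⊥
  pigeonhole (inj₁ refl) (inj₁ refl) _ x≢y _ _ = x≢y refl
  pigeonhole (inj₂ refl) (inj₂ refl) _ x≢y _ _ = x≢y refl
  pigeonhole (inj₁ refl) (inj₂ refl) (inj₁ refl) _ x≢w _ = x≢w refl
  pigeonhole (inj₁ refl) (inj₂ refl) (inj₂ refl) _ _ y≢w = y≢w refl
  pigeonhole (inj₂ refl) (inj₁ refl) (inj₁ refl) _ _ y≢w = y≢w refl
  pigeonhole (inj₂ refl) (inj₁ refl) (inj₂ refl) _ x≢w _ = x≢w refl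

  sameRan⇒samePair : ∀ {a₀ a₁ b₀ b₁} → a₀ ≢ a₁ → SameRan a₀ a₁ b₀ b₁ → SamePair a₀ a₁ b₀ b₁
  sameRan⇒samePair {a₀} {a₁} a₀≢a₁ same
    with proj₁ (same a₀) (inj₁ refl) | proj₁ (same a₁) (inj₂ refl)
  ... | inj₁ p | inj₁ q = ⊥-elim (a₀≢a₁ (trans p (sym q)))
  ... | inj₁ p | inj₂ q = inj₁ (p , q)
  ... | inj₂ p | inj₁ q = inj₂ (p , q)
  ... | inj₂ p | inj₂ q = ⊥-elim (a₀≢a₁ (trans p (sym q)))

module Combination {A D : Set} {F : OpSet A} (Δ : Δ² F)
                   (K : (D → A) → Set) (K-inv : Inv F K) where

  -- Two members of K that differ at p and at q, with different value sets
  -- there, merge into a member taking any of the offered values at p and at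
  -- q, and agreeing with both wherever they agree (w is idempotent).
  combine : ∀ {e₁ e₂} → K e₁ → K e₂ → (p q : D) {a₀ a₁ b₀ b₁ : A} →
            e₁ p ≡ a₀ → e₂ p ≡ a₁ → e₁ q ≡ b₀ → e₂ q ≡ b₁ →
            a₀ ≢ a₁ → b₀ ≢ b₁ → ¬ SamePair a₀ a₁ b₀ b₁ →
            ∀ a b → InPair a a₀ a₁ → InPair b b₀ b₁ →
            Σ (D → A) λ e → K e × e p ≡ a × e q ≡ b × (∀ x → e₁ x ≡ e₂ x → e x ≡ e₁ x)
  combine {e₁} {e₂} K₁ K₂ p q refl refl refl refl a₀≢a₁ b₀≢b₁ ¬same a b a∈ b∈
    with Δ (e₁ p) (e₂ p) (e₁ q) (e₂ q) a₀≢a₁ b₀≢b₁ (¬same ∘ sameRan⇒samePair a₀≢a₁) a b a∈ b∈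
  ... | w , w∈F , w-p , w-q , w-idem =
    apply w pair , K-inv w w∈F pair K-pair , w-p , w-q , keep
    where
      pair : Fin 2 → D → A
      pair Fin.zero = e₁
      pair (Fin.suc Fin.zero) = e₂

      K-pair : ∀ i → K (pair i)
      K-pair Fin.zero = K₁
      K-pair (Fin.suc Fin.zero) = K₂

      keep : ∀ x → e₁ x ≡ e₂ x → w (e₁ x ∷ e₂ x ∷ []) ≡ e₁ x
      keep x eq = trans (cong (λ v → w (e₁ x ∷ v ∷ [])) (sym eq)) (w-idem (e₁ x))

  Realises : D → D → A → A → Set
  Realises r s u v = Σ (D → A) λ e → K e × e r ≡ u × e s ≡ v

  module _ {r s : D} where

    setSnd : ∀ {u v x} → Realises r s u v → u ≢ v → Realises r s x x →
             x ≢ u → x ≢ v → Realises r s u x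
    setSnd (e , E , eu , ev) u≢v (d , D' , dx , dx') x≢u x≢v =
      let (e' , E' , e'u , e'x , _) =
            combine E D' r s eu dx ev dx' (≢-sym x≢u) (≢-sym x≢v)
                    (λ { (inj₁ (u≡v , _)) → u≢v u≡v ; (inj₂ (_ , x≡v)) → x≢v x≡v })
                    _ _ (inj₁ refl) (inj₂ refl)
      in e' , E' , e'u , e'x

    setFst : ∀ {u v x} → Realises r s u v → u ≢ v → Realises r s x x →
             x ≢ u → x ≢ v → Realises r s x v
    setFst (e , E , eu , ev) u≢v (d , D' , dx , dx') x≢u x≢v =
      let (e' , E' , e'x , e'v , _) =
            combine E D' r s eu dx ev dx' (≢-sym x≢u) (≢-sym x≢v)
                    (λ { (inj₁ (u≡v , _)) → u≢v u≡v ; (inj₂ (_ , x≡v)) → x≢v x≡v })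
                    _ _ (inj₂ refl) (inj₁ refl)
      in e' , E' , e'x , e'v

    module _ (_≟ₐ_ : DecidableEquality A) {c d z : A}
             (c≢d : c ≢ d) (c≢z : c ≢ z) (d≢z : d ≢ z)
             (C : Realises r s c c) (D' : Realises r s d d) (Z : Realises r s z z) where

      completeFst : ∀ {u} → Realises r s u c → u ≢ c → Realises r s d c
      completeFst {u} P u≢c with u ≟ₐ d
      ... | yes refl = P
      ... | no u≢d = setFst P u≢c D' (≢-sym u≢d) (≢-sym c≢d)

      completeSnd : ∀ {v} → Realises r s d v → d ≢ v → Realises r s d c
      completeSnd {v} P d≢v with v ≟ₐ c
      ... | yes refl = P
      ... | no v≢c = setSnd P d≢v C c≢d (≢-sym v≢c)

      swapPair : ∀ {u v} → Realises r s u v → u ≢ v → Realises r s d c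
      swapPair {u} {v} P u≢v with u ≟ₐ c | v ≟ₐ c
      ... | no u≢c | yes refl = completeFst P u≢c
      ... | no u≢c | no v≢c = completeFst (setSnd P u≢v C (≢-sym u≢c) (≢-sym v≢c)) u≢c
      ... | yes refl | _ with v ≟ₐ d
      ...   | no v≢d = completeSnd (setFst P u≢v D' (≢-sym c≢d) (≢-sym v≢d)) (≢-sym v≢d)
      ...   | yes refl =
              let cz = setSnd P c≢d Z (≢-sym c≢z) (≢-sym d≢z)
                  dz = setFst cz c≢z D' (≢-sym c≢d) d≢z
              in completeSnd dz d≢z

module _ {A : Set} {m : ℕ} (H : List (Vec A m)) where

  Identified : Fin m → Fin m → Set
  Identified p q = ∀ h → h ∈ H → lookup h p ≡ lookup h q

  row : ∀ {h} → h ∈ H → ⟦ H ⟧ (lookup h)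
  row {h} h∈ = h , h∈ , λ _ → refl

  ⟦⟧-identified : ∀ {p q e} → Identified p q → ⟦ H ⟧ e → e p ≡ e q
  ⟦⟧-identified {p} {q} id (h , h∈ , eq) = trans (sym (eq p)) (trans (id h h∈) (eq q))

  ⟦⟧-QB : ∀ {a b q e} → QB H a b q → ⟦ H ⟧ e → InPair (e q) a b
  ⟦⟧-QB {q = q} qb (h , h∈ , eq) = subst (λ v → InPair v _ _) (eq q) (qb h h∈)

module Decomposition {n m : ℕ} (H : List (Vec (Fin (suc n)) (suc m)))
  {F : OpSet (Fin (suc n))} (Δ : Δ² F) (H-inv : Inv F ⟦ H ⟧)
  {h₀ : Vec (Fin (suc n)) (suc m)} (h₀∈H : h₀ ∈ H) where

  private
    A Q : Set
    A = Fin (suc n)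
    Q = Fin (suc m)

  El : (Q → A) → Set
  El = ⟦ H ⟧

  open Combination Δ El H-inv

  Agrees : List Q → (Q → A) → (Q → A) → Set
  Agrees S e g = ∀ x → x ∈ S → e x ≡ g x

  AgreesOff : Q → List Q → (Q → A) → (Q → A) → Set
  AgreesOff t S e g = ∀ x → x ∈ S → x ≢ t → e x ≡ g x

  Solvable : List Q → (Q → A) → Set
  Solvable S g = Σ (Q → A) λ e → El e × Agrees S e g

  NearSolution : Q → List Q → (Q → A) → Set
  NearSolution t S g = Σ (Q → A) λ e → El e × AgreesOff t S e g

  solvable? : ∀ S g → Dec (Solvable S g)
  solvable? S g = map′ fromRow toRow (any? (λ h → all? (λ x → lookup h x ≟ g x) S) H)
    where
      RowFits : Vec A (suc m) → Set
      RowFits h = All (λ x → lookup h x ≡ g x) S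
      fromRow : Any RowFits H → Solvable S g
      fromRow found = let (h , h∈ , ag) = find found
                      in lookup h , row H h∈ , λ x x∈ → All.lookup ag x∈
      toRow : Solvable S g → Any RowFits H
      toRow (e , (h , h∈ , eqh) , ag) = lose h∈ (All.tabulate λ {x} x∈ → trans (eqh x) (ag x x∈))

  -- The local conditions of decomposability, restricted to S.
  record Local (S : List Q) (g : Q → A) : Set where
    field
      singles    : ∀ q → q ∈ S → Σ (Q → A) λ e → El e × e q ≡ g q
      identities : ∀ p q → p ∈ S → q ∈ S → Identified H p q → g p ≡ g q
      twoValued  : ∀ a b → a ≢ b → Σ (Q → A) λ e → El e × (∀ q → q ∈ S → QB H a b q → e q ≡ g q)

  Local-mono : ∀ {S T g} → (∀ {x} → x ∈ T → x ∈ S) → Local S g → Local T g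
  Local-mono T⊆S loc = record
    { singles    = λ q q∈ → singles q (T⊆S q∈)
    ; identities = λ p q p∈ q∈ → identities p q (T⊆S p∈) (T⊆S q∈)
    ; twoValued  = λ a b a≢b → let (e , E , ag) = twoValued a b a≢b
                               in e , E , λ q q∈ → ag q (T⊆S q∈) }
    where open Local loc

  NearSolvable : List Q → Set
  NearSolvable S = ∀ t → t ∈ S → ∀ g → Local S g → NearSolution t S g

  NoIdentity : List Q → Set
  NoIdentity S = ∀ p q → p ∈ S → q ∈ S → Identified H p q → p ≡ q

  Free : Q → Set
  Free r = ∀ a b → ¬ QB H a b r

  threeValues⇒free : ∀ {r u v w} → El u → El v → El w →
                     u r ≢ v r → u r ≢ w r → v r ≢ w r → Free r
  threeValues⇒free U V W u≢v u≢w v≢w a b qb =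
    pigeonhole (⟦⟧-QB H qb U) (⟦⟧-QB H qb V) (⟦⟧-QB H qb W) u≢v u≢w v≢w

  completeAt : ∀ {t S e g} → AgreesOff t S e g → e t ≡ g t → Agrees S e g
  completeAt {t} off at x x∈ with x ≟ t
  ... | yes refl = at
  ... | no x≢t = off x x∈ x≢t

  agreesOnTwo : ∀ {p q S e g} → e p ≡ g p → e q ≡ g q →
                (∀ x → x ∈ S → x ≢ p → x ≢ q → e x ≡ g x) → Agrees S e g
  agreesOnTwo {p} {q} ep eq rest x x∈ with x ≟ p | x ≟ q
  ... | yes refl | _ = ep
  ... | no _ | yes refl = eq
  ... | no x≢p | no x≢q = rest x x∈ x≢p x≢q

  combineNear : ∀ {S g p q e₁ e₂} → p ≢ q → p ∈ S → q ∈ S → El e₁ → El e₂ →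
                AgreesOff p S e₁ g → AgreesOff q S e₂ g → e₁ p ≢ g p → e₂ q ≢ g q →
                ¬ SamePair (e₁ p) (g p) (g q) (e₂ q) → Solvable S g
  combineNear {S} {g} {p} {q} {e₁} {e₂} p≢q p∈ q∈ E₁ E₂ off₁ off₂ miss₁ miss₂ ¬same =
    let (e , E , ep , eq , keep) =
          combine E₁ E₂ p q refl (off₂ p p∈ p≢q) (off₁ q q∈ (≢-sym p≢q)) refl
                  miss₁ (≢-sym miss₂) ¬same (g p) (g q) (inj₂ refl) (inj₁ refl)
        elsewhere : ∀ x → x ∈ S → x ≢ p → x ≢ q → e x ≡ g x
        elsewhere x x∈ x≢p x≢q =
          trans (keep x (trans (off₁ x x∈ x≢p) (sym (off₂ x x∈ x≢q)))) (off₁ x x∈ x≢p)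
    in e , E , agreesOnTwo ep eq elsewhere

  conflict : ∀ {S g p q e₁ e₂} → ¬ Solvable S g → p ≢ q → p ∈ S → q ∈ S → El e₁ → El e₂ →
             AgreesOff p S e₁ g → AgreesOff q S e₂ g →
             e₁ p ≢ g p × e₂ q ≢ g q × SamePair (e₁ p) (g p) (g q) (e₂ q)
  conflict {g = g} {p} {q} {e₁} {e₂} uns p≢q p∈ q∈ E₁ E₂ off₁ off₂ =
    miss₁ , miss₂ ,
    decidable-stable samePair? (uns ∘ combineNear p≢q p∈ q∈ E₁ E₂ off₁ off₂ miss₁ miss₂)
    where
      miss₁ : e₁ p ≢ g p
      miss₁ at = uns (e₁ , E₁ , completeAt off₁ at)
      miss₂ : e₂ q ≢ g q
      miss₂ at = uns (e₂ , E₂ , completeAt off₂ at)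
      samePair? : Dec (SamePair (e₁ p) (g p) (g q) (e₂ q))
      samePair? = ((e₁ p ≟ g q) ×-dec (g p ≟ e₂ q)) ⊎-dec ((e₁ p ≟ e₂ q) ×-dec (g p ≟ g q))

  forced : ∀ {S g p q e₁ e₂} → ¬ Solvable S g → p ≢ q → p ∈ S → q ∈ S → El e₁ → El e₂ →
           AgreesOff p S e₁ g → AgreesOff q S e₂ g → g p ≢ g q → e₁ p ≡ g q × e₂ q ≡ g p
  forced uns p≢q p∈ q∈ E₁ E₂ off₁ off₂ gp≢gq with conflict uns p≢q p∈ q∈ E₁ E₂ off₁ off₂
  ... | _ , _ , inj₁ (e₁≡ , ≡e₂) = e₁≡ , sym ≡e₂
  ... | _ , _ , inj₂ (_ , gp≡gq) = ⊥-elim (gp≢gq gp≡gq)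

  _[_≔_] : (Q → A) → Q → A → Q → A
  g [ r ≔ z ] = updateAt g r (const z)

  ≔-here : ∀ {g r z} → (g [ r ≔ z ]) r ≡ z
  ≔-here {g} {r} = updateAt-updates r g

  ≔-elsewhere : ∀ {g r z x} → x ≢ r → (g [ r ≔ z ]) x ≡ g x
  ≔-elsewhere {g} {r} {x = x} x≢r = updateAt-minimal x r g x≢r

  ≔-collision : ∀ {g r z t} → t ≢ r → (g [ r ≔ z ]) r ≡ (g [ r ≔ z ]) t → z ≡ g t
  ≔-collision {g} {r} t≢r eq = trans (sym (≔-here {g} {r})) (trans eq (≔-elsewhere t≢r))

  off-update : ∀ {r S e g z} → AgreesOff r S e g → AgreesOff r S e (g [ r ≔ z ])
  off-update off x x∈ x≢r = trans (off x x∈ x≢r) (sym (≔-elsewhere x≢r))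

  update-Local : ∀ {S g r w z} → NoIdentity S → Free r → El w → w r ≡ z →
                 Local S g → Local S (g [ r ≔ z ])
  update-Local {S} {g} {r} {w} {z} noId free W wr≡z loc = record
    { singles    = singles'
    ; identities = λ p q p∈ q∈ id → cong (g [ r ≔ z ]) (noId p q p∈ q∈ id)
    ; twoValued  = twoValued' }
    where
      open Local loc
      singles' : ∀ q → q ∈ S → Σ (Q → A) λ e → El e × e q ≡ (g [ r ≔ z ]) q
      singles' q q∈ with q ≟ r
      ... | yes refl = w , W , trans wr≡z (sym (≔-here {g} {r}))
      ... | no q≢r = let (e , E , eq) = singles q q∈ in e , E , trans eq (sym (≔-elsewhere q≢r))
      twoValued' : ∀ a b → a ≢ b → Σ (Q → A) λ e → El e ×
                   (∀ q → q ∈ S → QB H a b q → e q ≡ (g [ r ≔ z ]) q)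
      twoValued' a b a≢b = let (e , E , ag) = twoValued a b a≢b in e , E , agree {e} ag
        where
          agree : ∀ {e} → (∀ q → q ∈ S → QB H a b q → e q ≡ g q) →
                  ∀ q → q ∈ S → QB H a b q → e q ≡ (g [ r ≔ z ]) q
          agree ag q q∈ qb with q ≟ r
          ... | yes refl = ⊥-elim (free a b qb)
          ... | no q≢r = trans (ag q q∈ qb) (sym (≔-elsewhere q≢r))

  -- Overwriting an unsolvable g at r by z keeps it unsolvable, provided some
  -- near solution at another point s misses with a pair avoiding z: a
  -- solution of the new function would merge with it into one for g.
  update-unsolvable : ∀ {S g r s es z} → ¬ Solvable S g → r ∈ S → s ∈ S → s ≢ r →
                      El es → AgreesOff s S es g → es s ≢ g s → z ≢ g r →
                      ¬ InPair z (g s) (es s) → ¬ Solvable S (g [ r ≔ z ])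
  update-unsolvable {g = g} {r} {s} {es} {z} uns r∈ s∈ s≢r Es off es≢ z≢gr z∉ (e , E , ag) =
    uns (combineNear (≢-sym s≢r) r∈ s∈ E Es off' off
                     (λ er≡gr → z≢gr (trans (sym er≡z) er≡gr)) es≢ ¬same)
    where
      er≡z : e r ≡ z
      er≡z = trans (ag r r∈) (≔-here {g} {r})
      off' : AgreesOff r _ e g
      off' x x∈ x≢r = trans (ag x x∈) (≔-elsewhere x≢r)
      ¬same : ¬ SamePair (e r) (g r) (g s) (es s)
      ¬same same = z∉ (subst (λ v → InPair v (g s) (es s)) er≡z (samePair-fst same))

  module Unsolvable (S : List Q) (near : NearSolvable S) where

    -- An identity pair p ≢ q in S would let the near solution at p solve g.
    noIdentity : ∀ {g} → Local S g → ¬ Solvable S g → NoIdentity S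
    noIdentity {g} loc uns p q p∈ q∈ id with p ≟ q
    ... | yes p≡q = p≡q
    ... | no p≢q = ⊥-elim (uns (solvedBy (near p p∈ g loc)))
      where
        solvedBy : NearSolution p S g → Solvable S g
        solvedBy (e , E , off) =
          e , E , completeAt off (trans (⟦⟧-identified H id E)
                    (trans (off q q∈ (≢-sym p≢q)) (sym (Local.identities loc p q p∈ q∈ id))))

    -- The configuration reached by the argument below: g is unsolvable, the
    -- near solutions er, es at r ≢ s miss with er r = g s and es s = g r,
    -- and after overwriting g r by a third value z (so that g' = g[r ≔ z]
    -- is still locally consistent and unsolvable) the near solution es' of
    -- g' at s takes the value z.  Every such configuration is impossible.
    module Configuration
      {g : Q → A} (loc : Local S g) (uns : ¬ Solvable S g)
      {r s : Q} (r∈ : r ∈ S) (s∈ : s ∈ S) (r≢s : r ≢ s) {z : A}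
      {er es es' : Q → A} (Er : El er) (Es : El es) (Es' : El es')
      (off-r : AgreesOff r S er g) (off-s : AgreesOff s S es g)
      (off-s' : AgreesOff s S es' (g [ r ≔ z ]))
      (er≡gs : er r ≡ g s) (es≡gr : es s ≡ g r) (es'≡z : es' s ≡ z)
      (gr≢gs : g r ≢ g s) (z≢gr : z ≢ g r) (z≢gs : z ≢ g s)
      (loc' : Local S (g [ r ≔ z ])) (uns' : ¬ Solvable S (g [ r ≔ z ]))
      where

      noId : NoIdentity S
      noId = noIdentity loc uns

      -- If S = {r , s}: on these two coordinates er, es, es' are the
      -- diagonals of g s, g r, z and some row of H is not diagonal (r, s is
      -- no identity pair), so swapPair realises (g r , g s) and solves g.
      twoPoints : (∀ t → t ∈ S → t ≡ r ⊎ t ≡ s) → ⊥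
      twoPoints S⊆rs =
        let (h , h∈ , hr≢hs) = counterexample (λ h → lookup h r ≟ lookup h s) H
                                 (λ id → r≢s (noId r s r∈ s∈ id))
            (e , E , er' , es'') = swapPair _≟_ (≢-sym gr≢gs) (≢-sym z≢gs) (≢-sym z≢gr)
                                     (er , Er , er≡gs , off-r s s∈ (≢-sym r≢s))
                                     (es , Es , off-s r r∈ r≢s , es≡gr)
                                     (es' , Es' , trans (off-s' r r∈ r≢s) (≔-here {g} {r}) , es'≡z)
                                     (lookup h , row H h∈ , refl , refl) hr≢hs
        in uns (e , E , λ t t∈ → [ (λ { refl → er' }) , (λ { refl → es'' }) ]′ (S⊆rs t t∈))

      z∉r : ¬ InPair z (er r) (g r)
      z∉r (inj₁ z≡er) = z≢gs (trans z≡er er≡gs)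
      z∉r (inj₂ z≡gr) = z≢gr z≡gr

      -- A third point t: the near solutions of g and g' at t force
      -- g t = g s; then s is free, and overwriting g s by z leads to a
      -- conflict at (s , t) contradicting g r ≢ g s.
      thirdPoint : ∀ {t} → t ∈ S → t ≢ r → t ≢ s → ⊥
      thirdPoint {t} t∈ t≢r t≢s =
        let (et , Et , off-t) = near t t∈ g loc
            (_ , et≢gt , rt-pair) = conflict uns (≢-sym t≢r) r∈ t∈ Er Et off-r off-t
            z∉t : ¬ InPair z (g t) (et t)
            z∉t = outside-samePair rt-pair z∉r
            (et' , Et' , off-t') = near t t∈ (g [ r ≔ z ]) loc'
            (er≡g't , _) = forced uns' (≢-sym t≢r) r∈ t∈ Er Et' (off-update off-r) off-t'
                             (z∉t ∘ inj₁ ∘ ≔-collision {g} {r} t≢r)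
            gt≡gs : g t ≡ g s
            gt≡gs = trans (sym (trans er≡g't (≔-elsewhere t≢r))) er≡gs
            (eg , Eg , egs) = Local.singles loc s s∈
            free-s : Free s
            free-s = threeValues⇒free Es Eg Es'
                       (λ eq → gr≢gs (trans (sym es≡gr) (trans eq egs)))
                       (λ eq → z≢gr (sym (trans (sym es≡gr) (trans eq es'≡z))))
                       (λ eq → z≢gs (sym (trans (sym egs) (trans eq es'≡z))))
            loc'' = update-Local noId free-s Es' es'≡z loc
            uns'' = update-unsolvable uns s∈ t∈ t≢s Et off-t et≢gt z≢gs z∉t
            (et'' , Et'' , off-t'') = near t t∈ (g [ s ≔ z ]) loc''
            (es≡g''t , _) = forced uns'' (≢-sym t≢s) s∈ t∈ Es Et'' (off-update off-s) off-t''
                              (z∉t ∘ inj₁ ∘ ≔-collision {g} {s} t≢s)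
        in gr≢gs (trans (sym es≡gr) (trans es≡g''t (trans (≔-elsewhere t≢s) gt≡gs)))

      impossible : ⊥
      impossible with all∈? (λ t → (t ≟ r) ⊎-dec (t ≟ s)) S
      ... | yes S⊆rs = twoPoints S⊆rs
      ... | no S⊈rs = let (t , t∈ , t∉) = counterexample (λ t → (t ≟ r) ⊎-dec (t ≟ s)) S S⊈rs
                      in thirdPoint t∈ (t∉ ∘ inj₁) (t∉ ∘ inj₂)

    -- Let es be a near solution at s missing with the
    -- pair {g s , es s}, and let w ∈ H take at r ≢ s a value outside it.  The
    -- near solution er at r conflicts with es, so er r, g r, w r are three
    -- distinct values at r and r is free; overwriting g r by w r then
    -- produces the impossible configuration.
    pivot : ∀ {g r s w es} → Local S g → ¬ Solvable S g → r ∈ S → s ∈ S → r ≢ s →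
            El w → El es → AgreesOff s S es g → es s ≢ g s → ¬ InPair (w r) (g s) (es s) → ⊥
    pivot {g} {r} {s} {w} {es} loc uns r∈ s∈ r≢s W Es off-s es≢gs z∉ =
      let (er , Er , off-r) = near r r∈ g loc
          (er≢gr , _ , rs-pair) = conflict uns r≢s r∈ s∈ Er Es off-r off-s
          z≢gr = outside⇒≢ z∉ (samePair-snd rs-pair)
          z≢gs : w r ≢ g s
          z≢gs = z∉ ∘ inj₁
          (eg , Eg , egr) = Local.singles loc r r∈
          free-r = threeValues⇒free Er Eg W (λ eq → er≢gr (trans eq egr))
                     (≢-sym (outside⇒≢ z∉ (samePair-fst rs-pair)))
                     (λ eq → z≢gr (trans (sym eq) egr))
          loc' = update-Local (noIdentity loc uns) free-r W refl loc
          uns' = update-unsolvable uns r∈ s∈ (≢-sym r≢s) Es off-s es≢gs z≢gr z∉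
          (es' , Es' , off-s') = near s s∈ (g [ r ≔ w r ]) loc'
          (er≡g's , es'≡g'r) = forced uns' r≢s r∈ s∈ Er Es' (off-update off-r) off-s'
                                 (z≢gs ∘ ≔-collision {g} {r} (≢-sym r≢s))
          er≡gs = trans er≡g's (≔-elsewhere (≢-sym r≢s))
          es≡gr = sym (samePair-other rs-pair er≡gs (≢-sym es≢gs))
      in Configuration.impossible loc uns r∈ s∈ r≢s Er Es Es' off-r off-s off-s'
           er≡gs es≡gr (trans es'≡g'r (≔-here {g} {r}))
           (λ eq → er≢gr (trans er≡gs (sym eq))) z≢gr z≢gs loc' uns'

    -- Two distinct points p, q of S: their near solutions conflict on the
    -- pair B = {ep p , g p}.  S is not contained in Q^{[B]}_H (otherwise the
    -- local condition on Q^{[B]}_H solves g), so some row of H leaves B at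
    -- some r ∈ S; pivot at r against whichever of p, q differs from r.
    escape : ∀ {g p q} → Local S g → ¬ Solvable S g → p ≢ q → p ∈ S → q ∈ S → ⊥
    escape {g} {p} {q} loc uns p≢q p∈ q∈ =
      let (ep , Ep , off-p) = near p p∈ g loc
          (eq , Eq , off-q) = near q q∈ g loc
          (ep≢gp , eq≢gq , pq-pair) = conflict uns p≢q p∈ q∈ Ep Eq off-p off-q
          inB? = λ r h → (lookup h r ≟ ep p) ⊎-dec (lookup h r ≟ g p)
          (eB , EB , agB) = Local.twoValued loc (ep p) (g p) ep≢gp
          (r , r∈ , r∉QB) = counterexample (λ r → all∈? (inB? r) H) S
                              (λ S⊆QB → uns (eB , EB , λ x x∈ → agB x x∈ (S⊆QB x x∈)))
          (h , h∈ , hr∉B) = counterexample (inB? r) H r∉QB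
      in case r ≟ p of λ where
           (yes r≡p) → pivot loc uns r∈ q∈ (λ r≡q → p≢q (trans (sym r≡p) r≡q)) (row H h∈)
                         Eq off-q eq≢gq (outside-samePair pq-pair hr∉B)
           (no r≢p) → pivot loc uns r∈ p∈ r≢p (row H h∈) Ep off-p ep≢gp (hr∉B ∘ Sum.swap)

  unsolvable : ∀ {S g} → NearSolvable S → Local S g → ¬ Solvable S g → ⊥
  unsolvable {[]} _ _ uns = uns (lookup h₀ , row H h₀∈H , λ _ ())
  unsolvable {p ∷ S} {g} near loc uns with all∈? (_≟ p) (p ∷ S)
  ... | yes all≡p = let (e , E , ep) = Local.singles loc p (here refl)
                    in uns (e , E , λ x x∈ → subst (λ y → e y ≡ g y) (sym (all≡p x x∈)) ep)
  ... | no ¬all≡p = let (q , q∈ , q≢p) = counterexample (_≟ p) (p ∷ S) ¬all≡p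
                    in Unsolvable.escape (p ∷ S) near loc uns (≢-sym q≢p) (here refl) q∈

  without : Q → List Q → List Q
  without t = filter (λ x → ¬? (x ≟ t))

  without-shorter : ∀ {t S} → t ∈ S → length (without t S) < length S
  without-shorter {t} {S} t∈ = filter-notAll (λ x → ¬? (x ≟ t)) S (lose t∈ (λ t≢t → t≢t refl))

  solve : ∀ S → Acc (_<_ on length) S → ∀ g → Local S g → Solvable S g
  solve S (acc smaller) g loc = decidable-stable (solvable? S g) (unsolvable nearSolvable loc)
    where
      nearSolvable : NearSolvable S
      nearSolvable t t∈ g' loc' =
        let (e , E , ag) = solve (without t S) (smaller (without-shorter t∈)) g'
                                 (Local-mono (proj₁ ∘ ∈-filter⁻ (λ x → ¬? (x ≟ t))) loc')
        in e , E , λ x x∈ x≢t → ag x (∈-filter⁺ (λ x → ¬? (x ≟ t)) x∈ x≢t)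

  -- H is decomposable: the hypothesis of decomposability makes every
  -- candidate f locally consistent on all of Q.
  decomposable : Decomposable H (Family H)
  decomposable f = (λ { (h , h∈ , eq) _ → h , h∈ , λ q _ → eq q }) , fromLocal
    where
      fromLocal : (∀ i → InExt H (Family H i) f) → ⟦ H ⟧ f
      fromLocal ext =
        let (e , (h , h∈ , eqh) , ag) =
              solve (allFin (suc m)) (On.wellFounded length <-wellFounded _) f loc
        in h , h∈ , λ q → trans (eqh q) (ag q (∈-allFin q))
        where
          identities : ∀ p q → Identified H p q → f p ≡ f q
          identities p q id with p ≟ q
          ... | yes refl = refl
          ... | no p≢q = let (h , h∈ , ag) = ext (inj₂ (inj₁ (p , q , p≢q , id)))
                         in trans (sym (ag p (inj₁ refl))) (trans (id h h∈) (ag q (inj₂ refl)))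
          loc : Local (allFin (suc m)) f
          loc = record
            { singles    = λ q _ → let (h , h∈ , ag) = ext (inj₁ q)
                                   in lookup h , row H h∈ , ag q refl
            ; identities = λ p q _ _ → identities p q
            ; twoValued  = λ a b a≢b → let (h , h∈ , ag) = ext (inj₂ (inj₂ (a , b , a≢b)))
                                       in lookup h , row H h∈ , λ q _ → ag q }

module _ {A : Set} {m : ℕ} (H : List (Vec A m)) {F : OpSet A} where

  restriction-invariant : Inv F ⟦ H ⟧ → ∀ P → Inv F (Restr H P)
  restriction-invariant inv P g g∈F hs hs∈ =
    let (h , h∈ , eqh) = inv g g∈F (λ i → lookup (proj₁ (hs∈ i)))
                                   (λ i → row H (proj₁ (proj₂ (hs∈ i))))
    in h , h∈ , λ x → trans (eqh (proj₁ x)) (cong g (tabulate-cong (λ i → proj₂ (proj₂ (hs∈ i)) x)))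

  module _ {k} {g : Op A k} (g∈F : F g) {hs : Fin k → Fin m → A} (hs∈ : ∀ i → ⟦ H ⟧ (hs i)) where

    agreesOnRestriction : ∀ {P} → Inv F (Restr H P) → InExt H P (apply g hs)
    agreesOnRestriction invP =
      let (h , h∈ , eqh) = invP g g∈F (λ i x → hs i (proj₁ x))
                             (λ i → let (h , h∈ , eq) = hs∈ i in h , h∈ , λ x → eq (proj₁ x))
      in h , h∈ , λ q Pq → eqh (q , Pq)

    apply-identified : ∀ {p q} → Identified H p q → apply g hs p ≡ apply g hs q
    apply-identified id = cong g (tabulate-cong (λ i → ⟦⟧-identified H id (hs∈ i)))

  invariant-from-parts : (∀ q → Inv F (Restr H (Single H q))) →
                         (∀ a b → a ≢ b → Inv F (Restr H (QB H a b))) →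
                         Decomposable H (Family H) → Inv F ⟦ H ⟧
  invariant-from-parts singles pairs dec g g∈F hs hs∈ = proj₂ (dec (apply g hs)) onFamily
    where
      extend : ∀ {P} → Inv F (Restr H P) → InExt H P (apply g hs)
      extend = agreesOnRestriction g∈F hs∈

      onFamily : ∀ i → InExt H (Family H i) (apply g hs)
      onFamily (inj₁ q) = extend (singles q)
      onFamily (inj₂ (inj₂ (a , b , a≢b))) = extend (pairs a b a≢b)
      onFamily (inj₂ (inj₁ (p , q , _ , id))) =
        let (h , h∈ , ag) = extend (singles p)
        in h , h∈ , λ where
             _ (inj₁ refl) → ag p refl
             _ (inj₂ refl) → trans (sym (id h h∈)) (trans (ag p refl) (apply-identified g∈F hs∈ id))

theorem3 : (n m : ℕ) (H : List (Vec (Fin (suc n)) (suc m))) → ¬ (H ≡ []) →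
    (F : OpSet (Fin (suc n))) → IsClone F → Δ² F →
    (Inv F (⟦ H ⟧) →
      ((∀ q → Inv F (Restr H (Single H q))) × (∀ a b → a ≢ b → Inv F (Restr H (QB H a b)))
        × Decomposable H (Family H)))
    × (((∀ q → Inv F (Restr H (Single H q))) × (∀ a b → a ≢ b → Inv F (Restr H (QB H a b)))
        × Decomposable H (Family H)) → Inv F (⟦ H ⟧))
theorem3 n m H H≢[] F _ Δ = invariant⇒parts , parts⇒invariant
  where
    Parts : Set
    Parts = (∀ q → Inv F (Restr H (Single H q))) × (∀ a b → a ≢ b → Inv F (Restr H (QB H a b)))
            × Decomposable H (Family H)

    invariant⇒parts : Inv F ⟦ H ⟧ → Parts
    invariant⇒parts inv =
        (λ q → restriction-invariant H inv (Single H q))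
      , (λ a b _ → restriction-invariant H inv (QB H a b))
      , Decomposition.decomposable H Δ inv (proj₂ (nonempty H≢[]))

    parts⇒invariant : Parts → Inv F ⟦ H ⟧
    parts⇒invariant (singles , pairs , dec) = invariant-from-parts H singles pairs dec
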